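{- Let $k\geq 4$ and $h\geq 2$ be integers and let $G$ be an ordered additive abelian group with order $\preceq$. Suppose $a_1,\dots,a_{k-3}\in G$ satisfy $0\prec a_1\prec a_2\prec\cdots\prec a_{k-3}$. Let $b,c\in G$ with $0\prec b$, $0\prec c$, and suppose $c=db$ for some integer $d>1$. If $$A=\{0,a_1,a_2,\dots,a_{k-3},\,a_{k-3}+b,\,a_{k-3}+b+c\},$$ then $hA$ has at least $h-1$ nontrivial elements.
   Context: An ordered additive abelian group is an additive abelian group $G$ with a total order $\preceq$ such that for all $x,y,z\in G$, $x\prec y$ implies $x+z\prec y+z$ (here $\prec$ means $\preceq$ and $\neq$). For an integer $h\geq 2$ and $A\subseteq G$, the $h$-fold sumset is $hA=\{x_1+\cdots+x_h : x_1,\dots,x_h\in A\}$. For a positive integer $n$, $ng$ denotes the sum of $n$ copies of $g$. If $A=\{x_1,\dots,x_m\}$ with $x_1\prec x_2\prec\cdots\prec x_m$, an element of $hA$ is called trivial (with respect to $A$) if it equals $(h-i)x_j+ix_{j+1}$ for some integers $0\leq i\leq h$ and $1\leq j\leq m-1$; otherwise it is called nontrivial. -}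

module Defs where

open import Level using (Level; _⊔_) renaming (suc to lsuc)
open import Data.Nat using (ℕ; zero; suc; _≤_; _<_; _∸_; s≤s; z≤n)
open import Data.Nat.Properties using (≤-refl)
open import Data.Fin using (Fin; toℕ; fromℕ<)
open import Data.List using (List; []; _∷_; _++_; length; lookup; tabulate)
open import Data.Product using (Σ; ∃; _×_; _,_)
open import Relation.Binary.Core using (Rel)
open import Relation.Binary.PropositionalEquality using (_≡_; _≢_)
open import Relation.Binary.Structures using (IsTotalOrder)
open import Function.Definitions using (Injective)
import Algebra.Structures as AS

record OrderedAbelianGroup (c ℓ : Level) : Set (lsuc (c ⊔ ℓ)) where
  infixl 6 _+_
  infix 4 _⪯_
  field
    Carrier        : Set c
    _+_            : Carrier → Carrier → Carrier
    0#             : Carrier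
    -_             : Carrier → Carrier
    _⪯_            : Rel Carrier ℓ
    isAbelianGroup : AS.IsAbelianGroup _≡_ _+_ 0# -_
    isTotalOrder   : IsTotalOrder _≡_ _⪯_
    +-compat       : ∀ {x y z} → (x ⪯ y × x ≢ y) → ((x + z) ⪯ (y + z) × (x + z) ≢ (y + z))

  infix 4 _≺_
  _≺_ : Rel Carrier (c ⊔ ℓ)
  x ≺ y = x ⪯ y × x ≢ y

  _·_ : ℕ → Carrier → Carrier
  zero  · g = 0#
  suc n · g = n · g + g

  sumF : ∀ {n} → (Fin n → Carrier) → Carrier
  sumF {zero}  f = 0#
  sumF {suc n} f = f Fin.zero + sumF (λ i → f (Fin.suc i))
    where import Data.Fin as Fin

  -- Below, a finite set A is represented by its increasing enumeration,
  -- given as a list L = [x₁, …, x_m] (x₁ ≺ … ≺ x_m).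

  InSumset : ℕ → List Carrier → Carrier → Set c
  InSumset h L y = Σ (Fin h → Fin (length L)) λ f → sumF (λ t → lookup L (f t)) ≡ y

  -- y is trivial w.r.t. A: y = (h-i) x_j + i x_{j+1}, 0 ≤ i ≤ h, 1 ≤ j ≤ m-1
  Trivial : ℕ → List Carrier → Carrier → Set c
  Trivial h L y =
    Σ ℕ λ i → Σ ℕ λ j → Σ (suc j < length L) λ lt →
      i ≤ h × (((h ∸ i) · lookup L (fromℕ< (<-pred lt))) + (i · lookup L (fromℕ< lt)) ≡ y)
    where
    <-pred : ∀ {j m} → suc j < m → j < m
    <-pred {j} {suc m} (s≤s p) = go p
      where
      go : ∀ {a b} → suc a ≤ b → a < suc b
      go {zero}  {suc b} _ = s≤s z≤n
      go {suc a} {suc b} (s≤s q) = s≤s (go q)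

  AtLeastNontrivial : ℕ → List Carrier → ℕ → Set c
  AtLeastNontrivial h L n =
    Σ (Fin n → Carrier) λ e →
      Injective _≡_ _≡_ e × (∀ t → InSumset h L (e t) × (Trivial h L (e t) → Data.Empty.⊥))
    where import Data.Empty

-- for k ≥ 4, the index k-4 (i.e. a_{k-3}, 0-based) is valid in Fin (k ∸ 3)
lastIdx : ∀ {k} → 4 ≤ k → Fin (k ∸ 3)
lastIdx {suc (suc (suc (suc k)))} (s≤s (s≤s (s≤s (s≤s _)))) = fromℕ< {k} ≤-refl

setA : ∀ {c ℓ} (G : OrderedAbelianGroup c ℓ) (k : ℕ) → 4 ≤ k →
       (Fin (k ∸ 3) → OrderedAbelianGroup.Carrier G) →
       (b c : OrderedAbelianGroup.Carrier G) → List (OrderedAbelianGroup.Carrier G)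
setA G k hk a b c =
  0# ∷ (tabulate a ++ (a (lastIdx hk) + b) ∷ (a (lastIdx hk) + b + c) ∷ [])
  where open OrderedAbelianGroup G

{-# OPTIONS --safe #-}
-- Write u = a_{k-3}, v = u + b and w = u + b + c = u + (1 + d) b: these lie on the line u + ℕ b,
-- and every other element of A is at most u. For 1 ≤ j ≤ h - 1 the sum j w + (h - 1 - j) v + u
-- = h u + (h - 1 + j d) b lies in hA, and distinct j give distinct sums. None of them is trivial:
-- combinations of two elements below u are at most h u, those of u and v are h u + i b with
-- i ≤ h < h - 1 + j d, and those of v and w are h u + (h + i d) b, where h + i d = h - 1 + j d
-- would make d divide 1.
module Submission where

open import Defs
open import Data.Nat using (ℕ; _≤_; _<_; _∸_)
open import Data.Fin using (Fin; toℕ)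
open import Relation.Binary.PropositionalEquality using (_≡_)

import Data.Nat as ℕ
open import Data.Nat using (zero; suc; s≤s; z≤n; s<s⁻¹; >-nonZero)
import Data.Nat.Properties as ℕₚ
open import Data.Nat.Divisibility using (_∣_; ∣1⇒≡1; ∣m+n∣m⇒∣n; n∣m*n)
open import Data.Nat.Tactic.RingSolver using (solve-∀)
open import Data.Fin using (zero; suc; fromℕ; fromℕ<)
open import Data.Fin.Properties using (toℕ-injective; toℕ<n; ≤fromℕ; fromℕ-def)
import Data.Vec.Functional as Vector
open import Data.List using (List; []; _∷_; _++_; length; lookup; tabulate)
open import Data.List.Relation.Unary.Linked using (Linked; []; [-]; _∷_)
open import Data.List.Relation.Unary.Any using (here; there; index)
open import Data.List.Relation.Unary.Any.Properties using (lookup-index)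
open import Data.List.Membership.Propositional using (_∈_)
open import Data.List.Membership.Propositional.Properties using (∈-++⁺ˡ; ∈-++⁺ʳ; ∈-tabulate⁺)
open import Data.Product using (Σ-syntax; _×_; _,_)
open import Data.Sum using (inj₁; inj₂)
open import Data.Empty using (⊥-elim)
open import Relation.Binary.Definitions using (tri<; tri≈; tri>)
open import Function using (_∘_)
open import Function.Definitions using (Injective)
open import Relation.Nullary using (¬_)
open import Relation.Unary using (Pred)
open import Relation.Binary.Core using (Rel)
open import Relation.Binary.Structures using (IsTotalOrder)
open import Relation.Binary.PropositionalEquality
  using (_≢_; refl; sym; trans; cong; cong₂; subst; subst₂; module ≡-Reasoning)
open import Algebra.Bundles using (AbelianGroup)
open import Algebra.Structures using (IsAbelianGroup)
import Algebra.Properties.Group as GroupProperties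
import Algebra.Properties.CommutativeSemigroup as CommutativeSemigroupProperties
import Algebra.Properties.CommutativeMonoid.Mult as CommutativeMonoidMult

module _ {a r} {A : Set a} {R : Rel A r} where

  Linked-lookup : ∀ {xs} → Linked R xs → ∀ {j} (p : j < length xs) (q : suc j < length xs) →
                  R (lookup xs (fromℕ< p)) (lookup xs (fromℕ< q))
  Linked-lookup [-]       _       (s≤s ())
  Linked-lookup (Rxy ∷ _) {zero}  _ _ = Rxy
  Linked-lookup (_ ∷ Rxs) {suc j} p q = Linked-lookup Rxs (s<s⁻¹ p) (s<s⁻¹ q)

  Linked-∷-tabulate-++ : ∀ {p} {P : Pred A p} → (∀ {x y} → P x → P y → R x y) →
                         ∀ {n x ys} {f : Fin (suc n) → A} → P x → (∀ i → P (f i)) →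
                         Linked R (f (fromℕ n) ∷ ys) → Linked R (x ∷ tabulate f ++ ys)
  Linked-∷-tabulate-++ R-P {zero}  Px Pf Rys = R-P Px (Pf zero) ∷ Rys
  Linked-∷-tabulate-++ R-P {suc n} Px Pf Rys =
    R-P Px (Pf zero) ∷ Linked-∷-tabulate-++ R-P (Pf zero) (Pf ∘ suc) Rys

1+n<n+[1+j]*d : ∀ n j {d} → 1 < d → suc n < n ℕ.+ suc j ℕ.* d
1+n<n+[1+j]*d n j {d} 1<d = begin
  suc (suc n)         ≡⟨ ℕₚ.+-comm 2 n ⟩
  n ℕ.+ 2             ≤⟨ ℕₚ.+-monoʳ-≤ n 1<d ⟩
  n ℕ.+ d             ≤⟨ ℕₚ.+-monoʳ-≤ n (ℕₚ.m≤m+n d (j ℕ.* d)) ⟩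
  n ℕ.+ suc j ℕ.* d   ∎
  where open ℕₚ.≤-Reasoning

1+i*d≢j*d : ∀ i j {d} → 1 < d → suc (i ℕ.* d) ≢ j ℕ.* d
1+i*d≢j*d i j {d} 1<d eq = ℕₚ.<⇒≢ 1<d (sym (∣1⇒≡1 d∣1))
  where
  d∣1 : d ∣ 1
  d∣1 = ∣m+n∣m⇒∣n (subst (d ∣_) (trans (sym eq) (ℕₚ.+-comm 1 (i ℕ.* d))) (n∣m*n j))
                   (n∣m*n i)

module OrderedAbelianGroupProperties {c ℓ} (G : OrderedAbelianGroup c ℓ) where

  open OrderedAbelianGroup G
  open IsAbelianGroup isAbelianGroup using (comm; identityˡ; identityʳ)
  open IsTotalOrder isTotalOrder using (isPartialOrder)
  open ≡-Reasoning

  abelianGroup : AbelianGroup c c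
  abelianGroup = record
    { _≈_ = _≡_ ; _∙_ = _+_ ; ε = 0# ; _⁻¹ = -_ ; isAbelianGroup = isAbelianGroup }

  open AbelianGroup abelianGroup using (group; commutativeSemigroup; commutativeMonoid)
  open GroupProperties group using (∙-cancelˡ)
  open CommutativeSemigroupProperties commutativeSemigroup using (interchange; x∙yz≈yx∙z)
  module Mult = CommutativeMonoidMult commutativeMonoid

  ·≗× : ∀ n x → n · x ≡ n Mult.× x
  ·≗× zero    x = refl
  ·≗× (suc n) x = trans (cong (_+ x) (·≗× n x)) (comm _ x)

  ·-homo-+ : ∀ x m n → (m ℕ.+ n) · x ≡ m · x + n · x
  ·-homo-+ x m n = begin
    (m ℕ.+ n) · x             ≡⟨ ·≗× (m ℕ.+ n) x ⟩
    (m ℕ.+ n) Mult.× x        ≡⟨ Mult.×-homo-+ x m n ⟩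
    m Mult.× x + n Mult.× x   ≡⟨ cong₂ _+_ (·≗× m x) (·≗× n x) ⟨
    m · x + n · x             ∎

  ·-distrib-+ : ∀ x y n → n · (x + y) ≡ n · x + n · y
  ·-distrib-+ x y n = begin
    n · (x + y)               ≡⟨ ·≗× n (x + y) ⟩
    n Mult.× (x + y)          ≡⟨ Mult.×-distrib-+ x y n ⟩
    n Mult.× x + n Mult.× y   ≡⟨ cong₂ _+_ (·≗× n x) (·≗× n y) ⟨
    n · x + n · y             ∎

  ·-assocˡ : ∀ x m n → m · (n · x) ≡ (m ℕ.* n) · x
  ·-assocˡ x m n = begin
    m · (n · x)               ≡⟨ trans (·≗× m (n · x)) (cong (m Mult.×_) (·≗× n x)) ⟩
    m Mult.× (n Mult.× x)     ≡⟨ Mult.×-assocˡ x m n ⟩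
    (m ℕ.* n) Mult.× x        ≡⟨ ·≗× (m ℕ.* n) x ⟨
    (m ℕ.* n) · x             ∎

  open import Relation.Binary.Construct.NonStrictToStrict _≡_ _⪯_ using (<-trans; <-irrefl)
  -- Monotonicity is developed for the reflexive closure of ≺ rather than for ⪯: constructively
  -- x ⪯ y does not split into x ≺ y or x ≡ y, and + is only assumed to preserve ≺.
  open import Relation.Binary.Construct.StrictToNonStrict _≡_ _≺_ public
    using () renaming (_≤_ to _≼_)

  ≺-trans : ∀ {x y z} → x ≺ y → y ≺ z → x ≺ z
  ≺-trans = <-trans isPartialOrder

  ≺-irrefl : ∀ {x} → ¬ x ≺ x
  ≺-irrefl = <-irrefl refl

  ≼-≺-trans : ∀ {x y z} → x ≼ y → y ≺ z → x ≺ z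
  ≼-≺-trans (inj₁ x≺y) = ≺-trans x≺y
  ≼-≺-trans (inj₂ refl) y≺z = y≺z

  +-monoˡ-≺ : ∀ {x y} z → x ≺ y → x + z ≺ y + z
  +-monoˡ-≺ z = +-compat

  +-monoʳ-≺ : ∀ {x y} z → x ≺ y → z + x ≺ z + y
  +-monoʳ-≺ {x} {y} z x≺y = subst₂ _≺_ (comm x z) (comm y z) (+-compat x≺y)

  +-mono-≼ : ∀ {x x′ y y′} → x ≼ x′ → y ≼ y′ → x + y ≼ x′ + y′
  +-mono-≼ {x′ = x′} {y = y} (inj₁ x≺x′) (inj₁ y≺y′) =
    inj₁ (≺-trans (+-monoˡ-≺ y x≺x′) (+-monoʳ-≺ x′ y≺y′))
  +-mono-≼ {y = y} (inj₁ x≺x′) (inj₂ refl) = inj₁ (+-monoˡ-≺ y x≺x′)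
  +-mono-≼ {x = x} (inj₂ refl) (inj₁ y≺y′) = inj₁ (+-monoʳ-≺ x y≺y′)
  +-mono-≼ (inj₂ refl) (inj₂ refl) = inj₂ refl

  ·-monoʳ-≼ : ∀ n {x y} → x ≼ y → n · x ≼ n · y
  ·-monoʳ-≼ zero    x≼y = inj₂ refl
  ·-monoʳ-≼ (suc n) x≼y = +-mono-≼ (·-monoʳ-≼ n x≼y) x≼y

  x≺x+y : ∀ x {y} → 0# ≺ y → x ≺ x + y
  x≺x+y x {y} 0≺y = subst (_≺ x + y) (identityʳ x) (+-monoʳ-≺ x 0≺y)

  0≺[1+n]·x : ∀ n {x} → 0# ≺ x → 0# ≺ suc n · x
  0≺[1+n]·x zero    {x} 0≺x = subst (0# ≺_) (sym (identityˡ x)) 0≺x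
  0≺[1+n]·x (suc n) {x} 0≺x = ≺-trans (0≺[1+n]·x n 0≺x) (x≺x+y _ 0≺x)

  ·-strictMonoˡ : ∀ {x m n} → 0# ≺ x → m < n → m · x ≺ n · x
  ·-strictMonoˡ {x} {m} 0≺x m<n with o , refl ← ℕₚ.m≤n⇒∃[o]m+o≡n m<n =
    subst (λ k → m · x ≺ k · x) (ℕₚ.+-suc m o)
      (subst (m · x ≺_) (sym (·-homo-+ x m (suc o))) (x≺x+y (m · x) (0≺[1+n]·x o 0≺x)))

  ·-cancelʳ : ∀ {x m n} → 0# ≺ x → m · x ≡ n · x → m ≡ n
  ·-cancelʳ {x} {m} {n} 0≺x eq with ℕₚ.<-cmp m n
  ... | tri< m<n _ _ = ⊥-elim (≺-irrefl (subst (_≺ n · x) eq (·-strictMonoˡ 0≺x m<n)))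
  ... | tri≈ _ m≡n _ = m≡n
  ... | tri> _ _ n<m = ⊥-elim (≺-irrefl (subst (n · x ≺_) eq (·-strictMonoˡ 0≺x n<m)))

  ·x+·y≼·u : ∀ m n {x y u} → x ≼ u → y ≼ u → m · x + n · y ≼ (m ℕ.+ n) · u
  ·x+·y≼·u m n {u = u} x≼u y≼u =
    subst (_ ≼_) (sym (·-homo-+ u m n)) (+-mono-≼ (·-monoʳ-≼ m x≼u) (·-monoʳ-≼ n y≼u))

  strictMono⇒≼fromℕ : ∀ {n} {f : Fin (suc n) → Carrier} →
                      (∀ i j → toℕ i < toℕ j → f i ≺ f j) →
                      ∀ i → f i ≼ f (fromℕ n)
  strictMono⇒≼fromℕ {n} {f} f-mono i with ℕₚ.m≤n⇒m<n∨m≡n (≤fromℕ i)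
  ... | inj₁ i<n = inj₁ (f-mono i (fromℕ n) i<n)
  ... | inj₂ i≡n = inj₂ (cong f (toℕ-injective i≡n))

  inSumset-0 : ∀ {L} → InSumset 0 L 0#
  inSumset-0 = (λ ()) , refl

  inSumset-· : ∀ {L n x y} m → x ∈ L → InSumset n L y → InSumset (m ℕ.+ n) L (m · x + y)
  inSumset-· {L} {y = y} zero x∈L y∈nL = subst (InSumset _ L) (sym (identityˡ y)) y∈nL
  inSumset-· {L} {x = x} {y} (suc m) x∈L y∈nL =
    let f , f-sum = inSumset-· m x∈L y∈nL
    in  index x∈L Vector.∷ f ,
        trans (cong₂ _+_ (sym (lookup-index x∈L)) f-sum) (x∙yz≈yx∙z x (m · x) y)

  OnSegment : ℕ → Carrier → Carrier → Carrier → Set c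
  OnSegment h x y e = Σ[ i ∈ ℕ ] i ≤ h × (h ∸ i) · x + i · y ≡ e

  Linked⇒¬Trivial : ∀ {h L e} → Linked (λ x y → ¬ OnSegment h x y e) L → ¬ Trivial h L e
  Linked⇒¬Trivial link (i , j , j+1<∣L∣ , i≤h , eq) =
    Linked-lookup link (ℕₚ.<⇒≤ j+1<∣L∣) j+1<∣L∣ (i , i≤h , eq)

module Line {c ℓ} (G : OrderedAbelianGroup c ℓ) (u b : OrderedAbelianGroup.Carrier G)
            (0≺b : OrderedAbelianGroup._≺_ G (OrderedAbelianGroup.0# G) b) where

  open OrderedAbelianGroup G

  open IsAbelianGroup isAbelianGroup using (identityˡ; identityʳ)
  open OrderedAbelianGroupProperties G
  open AbelianGroup abelianGroup using (group; commutativeSemigroup)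
  open GroupProperties group using (∙-cancelˡ)
  open CommutativeSemigroupProperties commutativeSemigroup using (interchange)
  open ≡-Reasoning

  comb : ℕ → ℕ → Carrier
  comb m p = m · u + p · b

  pt : ℕ → Carrier
  pt q = u + q · b

  pt-zero : pt 0 ≡ u
  pt-zero = identityʳ u

  ·-pt : ∀ m q → m · pt q ≡ comb m (m ℕ.* q)
  ·-pt m q = trans (·-distrib-+ u (q · b) m) (cong (m · u +_) (·-assocˡ b m q))

  comb-+ : ∀ m p n q → comb m p + comb n q ≡ comb (m ℕ.+ n) (p ℕ.+ q)
  comb-+ m p n q = trans (interchange (m · u) (p · b) (n · u) (q · b))
                         (sym (cong₂ _+_ (·-homo-+ u m n) (·-homo-+ b p q)))

  comb-injective : ∀ {m p q} → comb m p ≡ comb m q → p ≡ q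
  comb-injective eq = ·-cancelʳ 0≺b (∙-cancelˡ _ _ _ eq)

  ·≺comb : ∀ m {p} → 0 < p → m · u ≺ comb m p
  ·≺comb m {suc p} _ = x≺x+y (m · u) (0≺[1+n]·x p 0≺b)

  inSumset-comb-0 : ∀ {L} → InSumset 0 L (comb 0 0)
  inSumset-comb-0 {L} = subst (InSumset 0 L) (sym (identityˡ 0#)) (inSumset-0 {L})

  inSumset-pt : ∀ {L n p} m {q} → pt q ∈ L → InSumset n L (comb n p) →
                InSumset (m ℕ.+ n) L (comb (m ℕ.+ n) (m ℕ.* q ℕ.+ p))
  inSumset-pt {L} {n} {p} m {q} pt∈L S = subst (InSumset _ L)
    (trans (cong (_+ comb n p) (·-pt m q)) (comb-+ m (m ℕ.* q) n p)) (inSumset-· m pt∈L S)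

  onSegment-pt : ∀ {h q q′ p} → OnSegment h (pt q) (pt q′) (comb h p) →
                 Σ[ i ∈ ℕ ] i ≤ h × (h ∸ i) ℕ.* q ℕ.+ i ℕ.* q′ ≡ p
  onSegment-pt {h} {q} {q′} {p} (i , i≤h , eq) = i , i≤h , comb-injective {h} (begin
    comb h ((h ∸ i) ℕ.* q ℕ.+ i ℕ.* q′)
      ≡⟨ cong (λ m → comb m ((h ∸ i) ℕ.* q ℕ.+ i ℕ.* q′)) (ℕₚ.m∸n+n≡m i≤h) ⟨
    comb ((h ∸ i) ℕ.+ i) ((h ∸ i) ℕ.* q ℕ.+ i ℕ.* q′)
      ≡⟨ comb-+ (h ∸ i) ((h ∸ i) ℕ.* q) i (i ℕ.* q′) ⟨
    comb (h ∸ i) ((h ∸ i) ℕ.* q) + comb i (i ℕ.* q′)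
      ≡⟨ cong₂ _+_ (·-pt (h ∸ i) q) (·-pt i q′) ⟨
    (h ∸ i) · pt q + i · pt q′
      ≡⟨ eq ⟩
    comb h p ∎)

  below-¬OnSegment : ∀ {h p x y} → 0 < p → x ≼ u → y ≼ u → ¬ OnSegment h x y (comb h p)
  below-¬OnSegment {h} {p} {x} {y} 0<p x≼u y≼u (i , i≤h , eq) =
    ≺-irrefl (subst (_≺ comb h p) eq (≼-≺-trans combination≼h·u (·≺comb h 0<p)))
    where
    combination≼h·u : (h ∸ i) · x + i · y ≼ h · u
    combination≼h·u = subst (λ m → (h ∸ i) · x + i · y ≼ m · u) (ℕₚ.m∸n+n≡m i≤h)
                            (·x+·y≼·u (h ∸ i) i x≼u y≼u)

  module NontrivialElements (h₁ d : ℕ) (1<d : 1 < d) where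

    -- With h = 1 + h₁ and j = 1 + t, element t is the sum j · w + (h₁ ∸ j) · v + u of h
    -- elements of A, where v = pt 1 and w = pt (1 + d).
    coefficient : Fin h₁ → ℕ
    coefficient t = h₁ ℕ.+ suc (toℕ t) ℕ.* d

    element : Fin h₁ → Carrier
    element t = comb (suc h₁) (coefficient t)

    1+h₁<coefficient : ∀ t → suc h₁ < coefficient t
    1+h₁<coefficient t = 1+n<n+[1+j]*d h₁ (toℕ t) 1<d

    element-injective : Injective _≡_ _≡_ element
    element-injective eq = toℕ-injective (ℕₚ.suc-injective
      (ℕₚ.*-cancelʳ-≡ _ _ d {{>-nonZero (ℕₚ.<-trans (s≤s z≤n) 1<d)}}
        (ℕₚ.+-cancelˡ-≡ h₁ _ _ (comb-injective {suc h₁} eq))))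

    element-∈-sumset : ∀ {L} → pt 0 ∈ L → pt 1 ∈ L → pt (suc d) ∈ L →
                       ∀ t → InSumset (suc h₁) L (element t)
    element-∈-sumset {L} u∈L v∈L w∈L t =
      subst₂ (λ n p → InSumset n L (comb n p)) size≡1+h₁ b-coefficient≡
        (inSumset-pt j {suc d} w∈L (inSumset-pt r {1} v∈L
          (inSumset-pt {p = 0} 1 {0} u∈L (inSumset-comb-0 {L}))))
      where
      j r : ℕ
      j = suc (toℕ t)
      r = h₁ ∸ j
      j+r≡h₁ : j ℕ.+ r ≡ h₁
      j+r≡h₁ = ℕₚ.m+[n∸m]≡n (toℕ<n t)
      size : ∀ j r → j ℕ.+ (r ℕ.+ (1 ℕ.+ 0)) ≡ suc (j ℕ.+ r)
      size = solve-∀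
      b-coefficient : ∀ j r d →
                      j ℕ.* suc d ℕ.+ (r ℕ.* 1 ℕ.+ (1 ℕ.* 0 ℕ.+ 0)) ≡ (j ℕ.+ r) ℕ.+ j ℕ.* d
      b-coefficient = solve-∀
      size≡1+h₁ : j ℕ.+ (r ℕ.+ (1 ℕ.+ 0)) ≡ suc h₁
      size≡1+h₁ = trans (size j r) (cong suc j+r≡h₁)
      b-coefficient≡ : j ℕ.* suc d ℕ.+ (r ℕ.* 1 ℕ.+ (1 ℕ.* 0 ℕ.+ 0)) ≡ coefficient t
      b-coefficient≡ = trans (b-coefficient j r d) (cong (ℕ._+ j ℕ.* d) j+r≡h₁)

    ¬OnSegment-u-v : ∀ t → ¬ OnSegment (suc h₁) (pt 0) (pt 1) (element t)
    ¬OnSegment-u-v t seg with i , i≤1+h₁ , i-coefficient ← onSegment-pt seg =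
      ℕₚ.<-irrefl i≡coefficient (ℕₚ.≤-<-trans i≤1+h₁ (1+h₁<coefficient t))
      where
      i≡coefficient : i ≡ coefficient t
      i≡coefficient =
        trans (sym (cong₂ ℕ._+_ (ℕₚ.*-zeroʳ (suc h₁ ∸ i)) (ℕₚ.*-identityʳ i))) i-coefficient

    ¬OnSegment-v-w : ∀ t → ¬ OnSegment (suc h₁) (pt 1) (pt (suc d)) (element t)
    ¬OnSegment-v-w t seg with i , i≤1+h₁ , i-coefficient ← onSegment-pt seg =
      1+i*d≢j*d i (suc (toℕ t)) 1<d (ℕₚ.+-cancelˡ-≡ h₁ _ _ (begin
        h₁ ℕ.+ suc (i ℕ.* d)                ≡⟨ ℕₚ.+-suc h₁ (i ℕ.* d) ⟩
        suc h₁ ℕ.+ i ℕ.* d                  ≡⟨ cong (ℕ._+ i ℕ.* d) (ℕₚ.m∸n+n≡m i≤1+h₁) ⟨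
        (suc h₁ ∸ i) ℕ.+ i ℕ.+ i ℕ.* d      ≡⟨ regroup (suc h₁ ∸ i) i d ⟩
        (suc h₁ ∸ i) ℕ.* 1 ℕ.+ i ℕ.* suc d  ≡⟨ i-coefficient ⟩
        coefficient t                       ∎))
      where
      regroup : ∀ m i d → m ℕ.+ i ℕ.+ i ℕ.* d ≡ m ℕ.* 1 ℕ.+ i ℕ.* suc d
      regroup = solve-∀

    atLeastNontrivial : ∀ {n v w} {f : Fin (suc n) → Carrier} → 0# ≺ u →
                        (∀ i j → toℕ i < toℕ j → f i ≺ f j) → f (fromℕ n) ≡ u →
                        v ≡ pt 1 → w ≡ pt (suc d) →
                        AtLeastNontrivial (suc h₁) (0# ∷ tabulate f ++ v ∷ w ∷ []) h₁
    atLeastNontrivial {n} {f = f} 0≺u f-mono last≡u refl refl =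
      element , element-injective ,
      λ t → element-∈-sumset u∈L v∈L w∈L t , Linked⇒¬Trivial (linked t)
      where
      L : List Carrier
      L = 0# ∷ tabulate f ++ pt 1 ∷ pt (suc d) ∷ []
      u∈L : pt 0 ∈ L
      u∈L = there (∈-++⁺ˡ (subst (_∈ tabulate f) (trans last≡u (sym pt-zero))
                                (∈-tabulate⁺ {f = f} (fromℕ n))))
      v∈L : pt 1 ∈ L
      v∈L = there (∈-++⁺ʳ (tabulate f) (here refl))
      w∈L : pt (suc d) ∈ L
      w∈L = there (∈-++⁺ʳ (tabulate f) (there (here refl)))
      f≼u : ∀ i → f i ≼ u
      f≼u i = subst (f i ≼_) last≡u (strictMono⇒≼fromℕ f-mono i)
      linked : ∀ t → Linked (λ x y → ¬ OnSegment (suc h₁) x y (element t)) L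
      linked t = Linked-∷-tabulate-++
        (below-¬OnSegment (ℕₚ.≤-<-trans z≤n (1+h₁<coefficient t))) {f = f} (inj₁ 0≺u) f≼u
        (subst (λ x → ¬ OnSegment (suc h₁) x (pt 1) (element t)) (trans pt-zero (sym last≡u))
               (¬OnSegment-u-v t)
          ∷ ¬OnSegment-v-w t ∷ [-])

theorem3p4 : ∀ {c ℓ} (G : OrderedAbelianGroup c ℓ) →
    let open OrderedAbelianGroup G in
    (k h : ℕ) → (hk : 4 ≤ k) → 2 ≤ h →
    (a : Fin (k ∸ 3) → Carrier) →
    (∀ i → 0# ≺ a i) →
    (∀ i j → toℕ i < toℕ j → a i ≺ a j) →
    (b c : Carrier) → 0# ≺ b → 0# ≺ c →
    (d : ℕ) → 1 < d → c ≡ d · b →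
    AtLeastNontrivial h (setA G k hk a b c) (h ∸ 1)
theorem3p4 G (suc (suc (suc (suc k)))) (suc h₁) (s≤s (s≤s (s≤s (s≤s _)))) (s≤s _)
           a 0≺a a-mono b c 0≺b _ d 1<d c≡d·b =
  atLeastNontrivial (0≺a _) a-mono (cong a (fromℕ-def k)) v≡pt1 w≡pt[1+d]
  where
  open OrderedAbelianGroup G
  open IsAbelianGroup isAbelianGroup using (assoc; comm; identityˡ)
  u : Carrier
  u = a (fromℕ< ℕₚ.≤-refl)
  open Line G u b 0≺b
  open NontrivialElements h₁ d 1<d
  v≡pt1 : u + b ≡ pt 1
  v≡pt1 = cong (u +_) (sym (identityˡ b))
  w≡pt[1+d] : u + b + c ≡ pt (suc d)
  w≡pt[1+d] = trans (assoc u b c) (cong (u +_) (trans (cong (b +_) c≡d·b) (comm b (d · b))))
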